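{- Let $W$ be an eventually periodic subset of $\mathbb{Z}^d$ with periods $u_1,\dots,u_d$, and let $\mathcal{W}$, $\mathscr{W}_1$ be as defined in the context. Suppose $\mathscr{W}_1$ contains exactly one element. Then $W$ has a minimal complement in $\mathbb{Z}^d$ if and only if there exists a nonempty finite subset $\mathcal{M}\subseteq\mathbb{Z}^d$ such that (1) $\pi$ restricted to $\mathcal{M}$ is injective; (2) $\pi(\mathcal{M}+(\mathcal{W}\cup\mathscr{W}_1))=\mathbb{Z}^d/\mathcal{L}$; (3) for every $m\in\mathcal{M}$ there exists $w\in\mathscr{W}_1$ such that $m+w\not\equiv m'+w'\pmod{\mathcal{L}}$ for all $m'\in\mathcal{M}\setminus\{m\}$ and $w'\in\mathcal{W}\cup\mathscr{W}_1$.
   Context: Let $d\geqslant 1$ and $\mathbb{N}=\{0,1,2,\dots\}$. Let $u_1,\dots,u_d\in\mathbb{Z}^d$ satisfy no nontrivial $\mathbb{Z}$-linear relation; put $P=\mathbb{N}u_1+\cdots+\mathbb{N}u_d$, $\mathcal{L}=\mathbb{Z}u_1+\cdots+\mathbb{Z}u_d$, and let $\pi:\mathbb{Z}^d\to\mathbb{Z}^d/\mathcal{L}$ be the quotient map. A nonempty $X\subseteq\mathbb{Z}^d$ is eventually periodic with periods $u_1,\dots,u_d$ if $X\subseteq F+P$ for some nonempty finite $F\subseteq\mathbb{Z}^d$ and $x+P\subseteq X$ for all but finitely many $x\in X$. For such $W$: $\mathscr{W}=\{w\in W: w+P\not\subseteq W\}$; $\mathcal{W}=\{w\in W\setminus\mathscr{W}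 : (w-P)\cap(W\setminus\mathscr{W})=\{w\}\}$; $\mathscr{W}_1$ is the set of elements of $\mathscr{W}$ congruent modulo $\mathcal{L}$ to no element of $\mathcal{W}$. A complement of $W$ in $\mathbb{Z}^d$ is a nonempty $M\subseteq\mathbb{Z}^d$ with $M+W=\mathbb{Z}^d$; it is minimal if no proper subset of $M$ is a complement of $W$. -}

module Defs where

open import Level using (0ℓ)
open import Data.Nat using (ℕ)
open import Data.Integer using (ℤ; +_; _+_; _-_; _*_)
open import Data.Fin using (Fin)
open import Data.Vec using (Vec; []; _∷_; zipWith; map; replicate; tabulate)
open import Data.List using (List)
open import Data.List.Membership.Propositional using (_∈_; _∉_)
open import Data.Sum using (_⊎_)
open import Data.Product using (Σ; ∃; ∃-syntax; _×_; _,_)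
open import Relation.Binary.PropositionalEquality using (_≡_)
open import Relation.Nullary using (¬_)
open import Relation.Unary using (Pred; _⊆_)

Zd : ℕ → Set
Zd d = Vec ℤ d

Subset : ℕ → Set₁
Subset d = Pred (Zd d) 0ℓ

_+ᵥ_ : ∀ {d} → Zd d → Zd d → Zd d
_+ᵥ_ = zipWith _+_

_-ᵥ_ : ∀ {d} → Zd d → Zd d → Zd d
_-ᵥ_ = zipWith _-_

0ᵥ : ∀ {d} → Zd d
0ᵥ = replicate _ (+ 0)

scale : ∀ {d} → ℤ → Zd d → Zd d
scale k v = map (k *_) v

sumV : ∀ {d k} → Vec (Zd d) k → Zd d
sumV [] = 0ᵥ
sumV (v ∷ vs) = v +ᵥ sumV vs

lincomb : ∀ {d k} → (Fin k → Zd d) → (Fin k → ℤ) → Zd d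
lincomb u c = sumV (tabulate (λ i → scale (c i) (u i)))

LinIndep : ∀ {d} → (Fin d → Zd d) → Set
LinIndep {d} u = ∀ (c : Fin d → ℤ) → lincomb u c ≡ 0ᵥ → ∀ i → c i ≡ + 0

module Periods {d : ℕ} (u : Fin d → Zd d) where

  InP : Pred (Zd d) 0ℓ
  InP x = Σ (Fin d → ℕ) λ c → x ≡ lincomb u (λ (i : Fin d) → + (c i))

  InL : Pred (Zd d) 0ℓ
  InL x = Σ (Fin d → ℤ) λ c → x ≡ lincomb u c

  -- congruence modulo 𝓛, i.e. π x ≡ π y
  _≡L_ : Zd d → Zd d → Set
  x ≡L y = InL (x -ᵥ y)

  TranslateP⊆ : Zd d → Subset d → Set
  TranslateP⊆ x X = ∀ p → InP p → X (x +ᵥ p)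

  EventuallyPeriodic : Subset d → Set
  EventuallyPeriodic X =
    (∃[ x ] X x)
    × (∃[ F ] ((∃[ f ] f ∈ F) × (∀ x → X x → ∃[ f ] ∃[ p ] (f ∈ F × InP p × x ≡ f +ᵥ p))))
    × (∃[ E ] (∀ x → X x → x ∉ E → TranslateP⊆ x X))

  module _ (W : Subset d) where

    WScr : Subset d
    WScr w = W w × ¬ TranslateP⊆ w W

    WGood : Subset d
    WGood w = W w × ¬ WScr w

    WCal : Subset d
    WCal w = WGood w × (∀ x → (∃[ p ] (InP p × x ≡ w -ᵥ p)) → WGood x → x ≡ w)

    WScr₁ : Subset d
    WScr₁ w = WScr w × (∀ v → WCal v → ¬ (w ≡L v))

    WCal∪WScr₁ : Subset d
    WCal∪WScr₁ w = WCal w ⊎ WScr₁ w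

  IsComplement : Subset d → Subset d → Set
  IsComplement W M = (∃[ m ] M m) × (∀ z → ∃[ m ] ∃[ w ] (M m × W w × m +ᵥ w ≡ z))

  IsMinimalComplement : Subset d → Subset d → Set₁
  IsMinimalComplement W M =
    IsComplement W M
    × ¬ (Σ (Subset d) λ M′ → M′ ⊆ M × (∃[ m ] (M m × ¬ M′ m)) × IsComplement W M′)

  HasMinimalComplement : Subset d → Set₁
  HasMinimalComplement W = Σ (Subset d) λ M → IsMinimalComplement W M

  Conditions : Subset d → List (Zd d) → Set
  Conditions W 𝓜 =
    (∃[ m ] m ∈ 𝓜)
    × (∀ m m′ → m ∈ 𝓜 → m′ ∈ 𝓜 → m ≡L m′ → m ≡ m′)
    × (∀ z → ∃[ m ] ∃[ w ] (m ∈ 𝓜 × WCal∪WScr₁ W w × (m +ᵥ w) ≡L z))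
    × (∀ m → m ∈ 𝓜 → ∃[ w ] (WScr₁ W w ×
         (∀ m′ w′ → m′ ∈ 𝓜 → ¬ (m′ ≡ m) → WCal∪WScr₁ W w′ → ¬ ((m +ᵥ w) ≡L (m′ +ᵥ w′)))))

module Submission where

-- Order ℤᵈ by x ≤ y ⇔ y − x ∈ P. Since W ⊆ F + P with F finite, every element of W∖𝒲scr
-- lies above an element of 𝒲cal in its class mod 𝓛 (a descent of bounded height), so each
-- class met by W is met by 𝒲cal ∪ 𝒲scr₁, where 𝒲scr₁ = {w₀}.
-- (⇐) For 𝓜 as in (1)–(3), the preimage π⁻¹(π 𝓜) is a complement. It is minimal: for m₁ in
-- the class of m ∈ 𝓜, condition (3) forces every representation of m₁ + w₀ to be m₁ + w₀.
-- (⇒) For a minimal complement M, call a class full if it lies in M + P. Writing z − N(u₁+⋯+u_d)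
-- in M + W for every N and applying the pigeonhole principle to F shows that the full classes
-- together with 𝒲cal ∪ 𝒲scr₁ cover ℤᵈ mod 𝓛; as 𝓛 has finite index, a transversal 𝓜 of the
-- full classes satisfies (1)–(3). A collision m + w₀ ≡ m′ + w′ with w′ ∈ 𝒲cal would let every
-- sum m* + w₁, for some m* ∈ M in the class of m, be rewritten with a summand of M ∖ {m*},
-- contradicting minimality.

open import Defs
open import Level using (0ℓ)
open import Function using (_∘_)
open import Function.Bundles using (_⇔_; mk⇔; Equivalence)
open import Axiom.ExcludedMiddle using (ExcludedMiddle)
open import Axiom.DoubleNegationElimination using (em⇒dne)
open import Data.Empty using (⊥; ⊥-elim)
open import Data.Sum using (_⊎_; inj₁; inj₂)
open import Data.Product using (Σ; ∃-syntax; _×_; _,_; proj₁; proj₂)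
open import Data.Maybe using (Maybe; just; nothing)
open import Data.Nat as ℕ using (ℕ; zero; suc; _≥_)
import Data.Nat.Properties as ℕP
open import Data.Integer as ℤ using (ℤ; +_; -[1+_]; _+_; _-_; _*_; -_)
import Data.Integer.Properties as ℤP
import Data.Integer.DivMod as ℤD
open import Data.Fin using (Fin; zero; suc; punchIn; fromℕ<)
open import Data.Fin.Properties using (all?; ¬∀⟶∃¬)
open import Data.Vec as V using ([]; _∷_; zipWith; replicate)
import Data.Vec.Properties as VP
open import Data.Vec.Functional using (removeAt; insertAt)
import Data.Vec.Functional as VF
import Data.Vec.Functional.Properties as VFP
open import Data.List as L using (List; []; _∷_)
open import Data.List.Membership.Propositional using (_∈_)
import Data.List.Membership.Propositional.Properties as MP
open import Data.List.Relation.Unary.Any using (here; there)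
open import Relation.Binary.PropositionalEquality
open import Relation.Binary.Bundles using (Setoid)
import Relation.Binary.Reasoning.Setoid as SetoidReasoning
open import Relation.Nullary using (¬_; Dec; yes; no)
open import Relation.Unary using (_⊆_)
open import Algebra.Bundles using (CommutativeRing)
open import Algebra.Structures using (IsCommutativeRing)
open import Algebra.Properties.AbelianGroup ℤP.+-0-abelianGroup using () renaming (xyx⁻¹≈y to ℤ+-xyx⁻¹≈y)
import Algebra.Properties.CommutativeMonoid.Sum as CommutativeMonoidSum
import Algebra.Solver.Ring as RingSolver
import Algebra.Solver.Ring.AlmostCommutativeRing as ACR

-- ℤᵈ as a pointwise commutative ring, so that scale k x = ι k ⊙ x and identities in ℤᵈ
-- with integer scalars are handled by the ring solver with coefficients in ℤ.
module _ {d : ℕ} where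

  infixl 25 _⊙_

  _⊙_ : Zd d → Zd d → Zd d
  _⊙_ = zipWith _*_

  negᵥ : Zd d → Zd d
  negᵥ = V.map (λ a → - a)

  ι : ℤ → Zd d
  ι = replicate d

  ℤᵈ-isCommutativeRing : IsCommutativeRing _≡_ _+ᵥ_ _⊙_ negᵥ 0ᵥ (ι (+ 1))
  ℤᵈ-isCommutativeRing = record
    { isRing = record
      { +-isAbelianGroup = record
        { isGroup = record
          { isMonoid = record
            { isSemigroup = record
              { isMagma = record { isEquivalence = isEquivalence ; ∙-cong = cong₂ _ }
              ; assoc = VP.zipWith-assoc ℤP.+-assoc }
            ; identity = VP.zipWith-identityˡ ℤP.+-identityˡ , VP.zipWith-identityʳ ℤP.+-identityʳ }
          ; inverse = VP.zipWith-inverseˡ ℤP.+-inverseˡ , VP.zipWith-inverseʳ ℤP.+-inverseʳ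
          ; ⁻¹-cong = cong _ }
        ; comm = VP.zipWith-comm ℤP.+-comm }
      ; *-cong = cong₂ _
      ; *-assoc = VP.zipWith-assoc ℤP.*-assoc
      ; *-identity = VP.zipWith-identityˡ ℤP.*-identityˡ , VP.zipWith-identityʳ ℤP.*-identityʳ
      ; distrib = VP.zipWith-distribˡ ℤP.*-distribˡ-+ , VP.zipWith-distribʳ ℤP.*-distribʳ-+ }
    ; *-comm = VP.zipWith-comm ℤP.*-comm }

  ℤᵈ-commutativeRing : CommutativeRing 0ℓ 0ℓ
  ℤᵈ-commutativeRing = record { isCommutativeRing = ℤᵈ-isCommutativeRing }

  ι-+ : ∀ a b → ι (a + b) ≡ ι a +ᵥ ι b
  ι-+ a b = sym (VP.zipWith-replicate _+_ a b)

  ι-* : ∀ a b → ι (a * b) ≡ ι a ⊙ ι b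
  ι-* a b = sym (VP.zipWith-replicate _*_ a b)

  ι-neg : ∀ a → ι (- a) ≡ negᵥ (ι a)
  ι-neg a = sym (VP.map-replicate (λ x → - x) a d)

  ι-homomorphism : ℤ.+-*-rawRing ACR.-Raw-AlmostCommutative⟶ ACR.fromCommutativeRing ℤᵈ-commutativeRing
  ι-homomorphism = record
    { ⟦_⟧ = ι ; +-homo = ι-+ ; *-homo = ι-* ; -‿homo = ι-neg ; 0-homo = refl ; 1-homo = refl }

  ι-≟ : ∀ a b → Maybe (ι a ≡ ι b)
  ι-≟ a b with a ℤ.≟ b
  ... | yes a≡b = just (cong ι a≡b)
  ... | no _ = nothing

  module ℤᵈ-Solver = RingSolver ℤ.+-*-rawRing (ACR.fromCommutativeRing ℤᵈ-commutativeRing) ι-homomorphism ι-≟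

  open ℤᵈ-Solver public using (solve; _:+_; _:*_; :-_; _:=_; con)

  +ᵥ-assoc : ∀ (x y z : Zd d) → (x +ᵥ y) +ᵥ z ≡ x +ᵥ (y +ᵥ z)
  +ᵥ-assoc = VP.zipWith-assoc ℤP.+-assoc

  +ᵥ-identityˡ : ∀ (x : Zd d) → 0ᵥ +ᵥ x ≡ x
  +ᵥ-identityˡ = VP.zipWith-identityˡ ℤP.+-identityˡ

  +ᵥ-identityʳ : ∀ (x : Zd d) → x +ᵥ 0ᵥ ≡ x
  +ᵥ-identityʳ = VP.zipWith-identityʳ ℤP.+-identityʳ

  +ᵥ-inverseʳ : ∀ (x : Zd d) → x +ᵥ negᵥ x ≡ 0ᵥ
  +ᵥ-inverseʳ = VP.zipWith-inverseʳ ℤP.+-inverseʳ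

  ⊙-zeroʳ : ∀ (x : Zd d) → x ⊙ 0ᵥ ≡ 0ᵥ
  ⊙-zeroʳ = VP.zipWith-zeroʳ ℤP.*-zeroʳ

  negᵥ-0ᵥ : negᵥ 0ᵥ ≡ 0ᵥ
  negᵥ-0ᵥ = VP.map-replicate (λ x → - x) (+ 0) d

  -ᵥ-+negᵥ : ∀ (x y : Zd d) → x -ᵥ y ≡ x +ᵥ negᵥ y
  -ᵥ-+negᵥ = go
    where
    go : ∀ {n} (x y : Zd n) → x -ᵥ y ≡ zipWith _+_ x (V.map (λ a → - a) y)
    go [] [] = refl
    go (a ∷ x) (b ∷ y) = cong (a - b ∷_) (go x y)

  scale-ι : ∀ k (x : Zd d) → scale k x ≡ ι k ⊙ x
  scale-ι k x = sym (VP.zipWith-replicate₁ _*_ k x)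

  scale-zero : ∀ (x : Zd d) → scale (+ 0) x ≡ 0ᵥ
  scale-zero x = trans (scale-ι _ x) (VP.zipWith-zeroˡ ℤP.*-zeroˡ x)

  scale-* : ∀ a b (x : Zd d) → scale (a * b) x ≡ ι a ⊙ scale b x
  scale-* a b x = begin
    scale (a * b) x      ≡⟨ trans (scale-ι _ x) (cong (_⊙ x) (ι-* a b)) ⟩
    ι a ⊙ ι b ⊙ x        ≡⟨ VP.zipWith-assoc ℤP.*-assoc _ _ x ⟩
    ι a ⊙ (ι b ⊙ x)      ≡⟨ cong (ι a ⊙_) (sym (scale-ι b x)) ⟩
    ι a ⊙ scale b x      ∎
    where open ≡-Reasoning

  +ᵥ-cancelˡ : ∀ {a b c : Zd d} → c +ᵥ a ≡ c +ᵥ b → a ≡ b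
  +ᵥ-cancelˡ {a} {b} {c} e = begin
    a                   ≡⟨ solve 2 (λ a c → a := (c :+ a) :+ (:- c)) refl a c ⟩
    (c +ᵥ a) +ᵥ negᵥ c  ≡⟨ cong (_+ᵥ negᵥ c) e ⟩
    (c +ᵥ b) +ᵥ negᵥ c  ≡⟨ solve 2 (λ b c → (c :+ b) :+ (:- c) := b) refl b c ⟩
    b                   ∎
    where open ≡-Reasoning

  +ᵥ-cancelʳ : ∀ {a b c : Zd d} → a +ᵥ c ≡ b +ᵥ c → a ≡ b
  +ᵥ-cancelʳ {a} {b} {c} e =
    +ᵥ-cancelˡ (trans (VP.zipWith-comm ℤP.+-comm c a) (trans e (VP.zipWith-comm ℤP.+-comm b c)))

module _ {d : ℕ} where

  lincomb-cong : ∀ {k} (v : Fin k → Zd d) {a b : Fin k → ℤ} → (∀ i → a i ≡ b i) →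
                 lincomb v a ≡ lincomb v b
  lincomb-cong {zero} v e = refl
  lincomb-cong {suc k} v e =
    cong₂ _+ᵥ_ (cong (λ t → scale t (v zero)) (e zero)) (lincomb-cong (v ∘ suc) (e ∘ suc))

  lincomb-zero : ∀ {k} (v : Fin k → Zd d) → lincomb v (λ _ → + 0) ≡ 0ᵥ
  lincomb-zero {zero} v = refl
  lincomb-zero {suc k} v =
    trans (cong₂ _+ᵥ_ (scale-zero (v zero)) (lincomb-zero (v ∘ suc))) (+ᵥ-identityˡ 0ᵥ)

  lincomb-+ : ∀ {k} (v : Fin k → Zd d) (a b : Fin k → ℤ) →
              lincomb v (λ i → a i + b i) ≡ lincomb v a +ᵥ lincomb v b
  lincomb-+ {zero} v a b = sym (+ᵥ-identityˡ 0ᵥ)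
  lincomb-+ {suc k} v a b = begin
    scale (a zero + b zero) (v zero) +ᵥ lincomb (v ∘ suc) (λ i → a (suc i) + b (suc i))
      ≡⟨ cong₂ _+ᵥ_ (trans (scale-ι _ _) (cong (_⊙ v zero) (ι-+ (a zero) (b zero))))
                    (lincomb-+ (v ∘ suc) (a ∘ suc) (b ∘ suc)) ⟩
    (ι (a zero) +ᵥ ι (b zero)) ⊙ v zero +ᵥ (A +ᵥ B)
      ≡⟨ solve 5 (λ x y z p q → (x :+ y) :* z :+ (p :+ q) := (x :* z :+ p) :+ (y :* z :+ q))
               refl (ι (a zero)) (ι (b zero)) (v zero) A B ⟩
    (ι (a zero) ⊙ v zero +ᵥ A) +ᵥ (ι (b zero) ⊙ v zero +ᵥ B)
      ≡⟨ sym (cong₂ _+ᵥ_ (cong (_+ᵥ A) (scale-ι (a zero) (v zero))) (cong (_+ᵥ B) (scale-ι (b zero) (v zero)))) ⟩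
    lincomb v a +ᵥ lincomb v b ∎
    where
    open ≡-Reasoning
    A B : Zd d
    A = lincomb (v ∘ suc) (a ∘ suc)
    B = lincomb (v ∘ suc) (b ∘ suc)

  lincomb-* : ∀ {k} (v : Fin k → Zd d) (c : ℤ) (a : Fin k → ℤ) →
              lincomb v (λ i → c * a i) ≡ ι c ⊙ lincomb v a
  lincomb-* {zero} v c a = sym (⊙-zeroʳ (ι c))
  lincomb-* {suc k} v c a = begin
    scale (c * a zero) (v zero) +ᵥ lincomb (v ∘ suc) (λ i → c * a (suc i))
      ≡⟨ cong₂ _+ᵥ_ (trans (scale-ι _ _) (cong (_⊙ v zero) (ι-* c (a zero)))) (lincomb-* (v ∘ suc) c (a ∘ suc)) ⟩
    ι c ⊙ ι (a zero) ⊙ v zero +ᵥ ι c ⊙ A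
      ≡⟨ solve 4 (λ x y z p → x :* y :* z :+ x :* p := x :* (y :* z :+ p)) refl (ι c) (ι (a zero)) (v zero) A ⟩
    ι c ⊙ (ι (a zero) ⊙ v zero +ᵥ A)
      ≡⟨ cong (λ t → ι c ⊙ (t +ᵥ A)) (sym (scale-ι (a zero) (v zero))) ⟩
    ι c ⊙ lincomb v a ∎
    where
    open ≡-Reasoning
    A : Zd d
    A = lincomb (v ∘ suc) (a ∘ suc)

  lincomb-neg : ∀ {k} (v : Fin k → Zd d) (a : Fin k → ℤ) →
                lincomb v (λ i → - a i) ≡ negᵥ (lincomb v a)
  lincomb-neg v a = begin
    lincomb v (λ i → - a i)          ≡⟨ lincomb-cong v (λ i → sym (ℤP.-1*i≡-i (a i))) ⟩
    lincomb v (λ i → ℤ.-1ℤ * a i)    ≡⟨ lincomb-* v ℤ.-1ℤ a ⟩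
    ι ℤ.-1ℤ ⊙ lincomb v a            ≡⟨ solve 1 (λ x → con ℤ.-1ℤ :* x := :- x) refl (lincomb v a) ⟩
    negᵥ (lincomb v a)               ∎
    where open ≡-Reasoning

lincomb-linear : ∀ {m n k} (f : Zd m → Zd n) → f 0ᵥ ≡ 0ᵥ →
                 (∀ x y → f (x +ᵥ y) ≡ f x +ᵥ f y) → (∀ c x → f (scale c x) ≡ scale c (f x)) →
                 ∀ (v : Fin k → Zd m) c → lincomb (f ∘ v) c ≡ f (lincomb v c)
lincomb-linear {k = zero} f f-0 f-+ f-scale v c = sym f-0
lincomb-linear {k = suc k} f f-0 f-+ f-scale v c = begin
  scale (c zero) (f (v zero)) +ᵥ lincomb (f ∘ v ∘ suc) (c ∘ suc)
    ≡⟨ cong₂ _+ᵥ_ (sym (f-scale (c zero) (v zero))) (lincomb-linear f f-0 f-+ f-scale (v ∘ suc) (c ∘ suc)) ⟩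
  f (scale (c zero) (v zero)) +ᵥ f (lincomb (v ∘ suc) (c ∘ suc))
    ≡⟨ sym (f-+ _ _) ⟩
  f (lincomb v c) ∎
  where open ≡-Reasoning

lincomb-removeAt : ∀ {n k} (v : Fin (suc k) → Zd n) c i →
                   lincomb v c ≡ scale (c i) (v i) +ᵥ lincomb (removeAt v i) (removeAt c i)
lincomb-removeAt {n} v c i = begin
  lincomb v c
    ≡⟨ as-sum v c ⟩
  ∑.sum (λ j → scale (c j) (v j))
    ≡⟨ ∑.sum-remove {i = i} (λ j → scale (c j) (v j)) ⟩
  scale (c i) (v i) +ᵥ ∑.sum (removeAt (λ j → scale (c j) (v j)) i)
    ≡⟨ cong (scale (c i) (v i) +ᵥ_) (sym (as-sum (removeAt v i) (removeAt c i))) ⟩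
  scale (c i) (v i) +ᵥ lincomb (removeAt v i) (removeAt c i) ∎
  where
  open ≡-Reasoning
  module ∑ = CommutativeMonoidSum (CommutativeRing.+-commutativeMonoid (ℤᵈ-commutativeRing {n}))
  as-sum : ∀ {k} (v : Fin k → Zd n) c → lincomb v c ≡ ∑.sum (λ i → scale (c i) (v i))
  as-sum {zero} v c = refl
  as-sum {suc k} v c = cong (scale (c zero) (v zero) +ᵥ_) (as-sum (v ∘ suc) (c ∘ suc))

module _ {n : ℕ} where

  head-+ : ∀ (x y : Zd (suc n)) → V.head (x +ᵥ y) ≡ V.head x + V.head y
  head-+ (a ∷ x) (b ∷ y) = refl

  head-scale : ∀ c (x : Zd (suc n)) → V.head (scale c x) ≡ c * V.head x
  head-scale c (a ∷ x) = refl

  head∷tail : ∀ (x : Zd (suc n)) → x ≡ V.head x ∷ V.tail x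
  head∷tail (a ∷ x) = refl

  lincomb-tail : ∀ {k} (v : Fin k → Zd (suc n)) c → lincomb (V.tail ∘ v) c ≡ V.tail (lincomb v c)
  lincomb-tail = lincomb-linear V.tail refl tail-+ tail-scale
    where
    tail-+ : ∀ (x y : Zd (suc n)) → V.tail (x +ᵥ y) ≡ V.tail x +ᵥ V.tail y
    tail-+ (a ∷ x) (b ∷ y) = refl
    tail-scale : ∀ c (x : Zd (suc n)) → V.tail (scale c x) ≡ scale c (V.tail x)
    tail-scale c (a ∷ x) = refl

  lincomb-head≡0 : ∀ {k} (v : Fin k → Zd (suc n)) c → (∀ i → V.head (v i) ≡ + 0) →
                   V.head (lincomb v c) ≡ + 0
  lincomb-head≡0 {zero} v c h = refl
  lincomb-head≡0 {suc k} v c h = begin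
    V.head (scale (c zero) (v zero) +ᵥ lincomb (v ∘ suc) (c ∘ suc))
      ≡⟨ head-+ (scale (c zero) (v zero)) _ ⟩
    V.head (scale (c zero) (v zero)) + V.head (lincomb (v ∘ suc) (c ∘ suc))
      ≡⟨ cong₂ _+_ (trans (head-scale (c zero) (v zero)) (trans (cong (c zero *_) (h zero)) (ℤP.*-zeroʳ (c zero))))
                   (lincomb-head≡0 (v ∘ suc) (c ∘ suc) (h ∘ suc)) ⟩
    + 0 ∎
    where open ≡-Reasoning

  lincomb-headless : ∀ {k} (v : Fin k → Zd (suc n)) c → (∀ i → V.head (v i) ≡ + 0) →
                     lincomb (V.tail ∘ v) c ≡ 0ᵥ → lincomb v c ≡ 0ᵥ
  lincomb-headless v c h e =
    trans (head∷tail _) (cong₂ _∷_ (lincomb-head≡0 v c h) (trans (sym (lincomb-tail v c)) e))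

  eliminate : Zd (suc n) → Zd (suc n) → Zd (suc n)
  eliminate x y = scale (V.head x) y +ᵥ negᵥ (scale (V.head y) x)

  head-eliminate : ∀ x y → V.head (eliminate x y) ≡ + 0
  head-eliminate (a ∷ x) (b ∷ y) = trans (cong (λ t → a * b - t) (ℤP.*-comm b a)) (ℤP.+-inverseʳ (a * b))

  eliminate-ι : ∀ x y → eliminate x y ≡ ι (V.head x) ⊙ y +ᵥ negᵥ (ι (V.head y) ⊙ x)
  eliminate-ι x y = cong₂ (λ p q → p +ᵥ negᵥ q) (scale-ι _ y) (scale-ι _ x)

  lincomb-eliminate : ∀ {k} x (v : Fin k → Zd (suc n)) c →
                      lincomb (eliminate x ∘ v) c ≡ eliminate x (lincomb v c)
  lincomb-eliminate x = lincomb-linear (eliminate x) elim-0 elim-+ elim-scale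
    where
    open ≡-Reasoning
    a : ℤ
    a = V.head x
    elim-0 : eliminate x 0ᵥ ≡ 0ᵥ
    elim-0 = begin
      eliminate x 0ᵥ                   ≡⟨ eliminate-ι x 0ᵥ ⟩
      ι a ⊙ 0ᵥ +ᵥ negᵥ (ι (+ 0) ⊙ x)   ≡⟨ solve 2 (λ A X → A :* con (+ 0) :+ :- (con (+ 0) :* X) := con (+ 0)) refl (ι a) x ⟩
      0ᵥ                               ∎
    elim-+ : ∀ y z → eliminate x (y +ᵥ z) ≡ eliminate x y +ᵥ eliminate x z
    elim-+ y z = begin
      eliminate x (y +ᵥ z)
        ≡⟨ eliminate-ι x _ ⟩
      ι a ⊙ (y +ᵥ z) +ᵥ negᵥ (ι (V.head (y +ᵥ z)) ⊙ x)
        ≡⟨ cong (λ t → ι a ⊙ (y +ᵥ z) +ᵥ negᵥ (t ⊙ x)) (trans (cong ι (head-+ y z)) (ι-+ _ _)) ⟩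
      ι a ⊙ (y +ᵥ z) +ᵥ negᵥ ((ι (V.head y) +ᵥ ι (V.head z)) ⊙ x)
        ≡⟨ solve 6 (λ A X Y Z P Q → A :* (Y :+ Z) :+ :- ((P :+ Q) :* X) := (A :* Y :+ :- (P :* X)) :+ (A :* Z :+ :- (Q :* X)))
                 refl (ι a) x y z (ι (V.head y)) (ι (V.head z)) ⟩
      (ι a ⊙ y +ᵥ negᵥ (ι (V.head y) ⊙ x)) +ᵥ (ι a ⊙ z +ᵥ negᵥ (ι (V.head z) ⊙ x))
        ≡⟨ sym (cong₂ _+ᵥ_ (eliminate-ι x y) (eliminate-ι x z)) ⟩
      eliminate x y +ᵥ eliminate x z ∎
    elim-scale : ∀ c y → eliminate x (scale c y) ≡ scale c (eliminate x y)
    elim-scale c y = begin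
      eliminate x (scale c y)
        ≡⟨ eliminate-ι x _ ⟩
      ι a ⊙ scale c y +ᵥ negᵥ (ι (V.head (scale c y)) ⊙ x)
        ≡⟨ cong₂ (λ p q → ι a ⊙ p +ᵥ negᵥ (q ⊙ x)) (scale-ι c y) (trans (cong ι (head-scale c y)) (ι-* _ _)) ⟩
      ι a ⊙ (ι c ⊙ y) +ᵥ negᵥ (ι c ⊙ ι (V.head y) ⊙ x)
        ≡⟨ solve 5 (λ A X Y C P → A :* (C :* Y) :+ :- (C :* P :* X) := C :* (A :* Y :+ :- (P :* X)))
                 refl (ι a) x y (ι c) (ι (V.head y)) ⟩
      ι c ⊙ (ι a ⊙ y +ᵥ negᵥ (ι (V.head y) ⊙ x))
        ≡⟨ sym (trans (scale-ι c _) (cong (ι c ⊙_) (eliminate-ι x y))) ⟩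
      scale c (eliminate x y) ∎

Dependent : ∀ {n k} → (Fin k → Zd n) → Set
Dependent {k = k} v = ∃[ c ] (∃[ i ] ¬ c i ≡ + 0) × lincomb v c ≡ 0ᵥ

dependent-by-pivot : ∀ {n k} (v : Fin (suc k) → Zd (suc n)) i → ¬ V.head (v i) ≡ + 0 →
                     Dependent (V.tail ∘ eliminate (v i) ∘ removeAt v i) → Dependent v
dependent-by-pivot {n} {k} v i a≢0 (c′ , (j , c′j≢0) , e′) = c , (punchIn i j , cj≢0) , e
  where
  open ≡-Reasoning
  x : Zd (suc n)
  x = v i
  w : Fin k → Zd (suc n)
  w = removeAt v i
  L : Zd (suc n)
  L = lincomb w c′
  a s : ℤ
  a = V.head x
  s = V.head L
  c : Fin (suc k) → ℤ
  c = insertAt (λ j → a * c′ j) i (- s)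
  cj≢0 : ¬ c (punchIn i j) ≡ + 0
  cj≢0 eq with ℤP.i*j≡0⇒i≡0∨j≡0 a (trans (sym (VFP.insertAt-punchIn _ i (- s) j)) eq)
  ... | inj₁ a≡0 = a≢0 a≡0
  ... | inj₂ c′j≡0 = c′j≢0 c′j≡0
  e : lincomb v c ≡ 0ᵥ
  e = begin
    lincomb v c
      ≡⟨ lincomb-removeAt v c i ⟩
    scale (c i) x +ᵥ lincomb w (removeAt c i)
      ≡⟨ cong₂ _+ᵥ_ (cong (λ t → scale t x) (VFP.insertAt-lookup _ i (- s)))
                    (lincomb-cong w (VFP.insertAt-punchIn _ i (- s))) ⟩
    scale (- s) x +ᵥ lincomb w (λ j → a * c′ j)
      ≡⟨ cong₂ _+ᵥ_ (trans (scale-ι (- s) x) (cong (_⊙ x) (ι-neg s))) (lincomb-* w a c′) ⟩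
    negᵥ (ι s) ⊙ x +ᵥ ι a ⊙ L
      ≡⟨ solve 4 (λ S X A L → (:- S) :* X :+ A :* L := A :* L :+ :- (S :* X)) refl (ι s) x (ι a) L ⟩
    ι a ⊙ L +ᵥ negᵥ (ι s ⊙ x)
      ≡⟨ sym (trans (lincomb-eliminate x w c′) (eliminate-ι x L)) ⟩
    lincomb (eliminate x ∘ w) c′
      ≡⟨ lincomb-headless (eliminate x ∘ w) c′ (λ j → head-eliminate x (w j)) e′ ⟩
    0ᵥ ∎

dependent : ∀ {n k} → n ℕ.< k → (v : Fin k → Zd n) → Dependent v
dependent {zero} {suc k} _ v = (λ _ → + 1) , (zero , λ ()) , zero-dimensional _
  where
  zero-dimensional : (x : Zd 0) → x ≡ 0ᵥ
  zero-dimensional [] = refl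
dependent {suc n} {suc k} (ℕ.s≤s n<k) v with all? (λ i → V.head (v i) ℤ.≟ + 0)
... | yes heads≡0 =
  let (c , c≢0 , e) = dependent (ℕP.m<n⇒m<1+n n<k) (V.tail ∘ v) in c , c≢0 , lincomb-headless v c heads≡0 e
... | no ¬heads≡0 =
  let (i , a≢0) = ¬∀⟶∃¬ _ _ (λ i → V.head (v i) ℤ.≟ + 0) ¬heads≡0
  in dependent-by-pivot v i a≢0 (dependent n<k _)

basis : ∀ {k} → Fin k → Zd k
basis {suc k} zero = + 1 ∷ 0ᵥ
basis {suc k} (suc j) = + 0 ∷ basis j

lincomb-basis : ∀ {k} (c : Fin k → ℤ) → lincomb basis c ≡ V.tabulate c
lincomb-basis {zero} c = refl
lincomb-basis {suc k} c = begin
  scale (c zero) (+ 1 ∷ 0ᵥ) +ᵥ lincomb ((+ 0 ∷_) ∘ basis) (c ∘ suc)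
    ≡⟨ cong (scale (c zero) (+ 1 ∷ 0ᵥ) +ᵥ_) (lincomb-linear (+ 0 ∷_) refl (λ _ _ → refl)
                                               (λ a x → cong (_∷ scale a x) (sym (ℤP.*-zeroʳ a))) basis (c ∘ suc)) ⟩
  (c zero * + 1 + + 0) ∷ (scale (c zero) 0ᵥ +ᵥ lincomb basis (c ∘ suc))
    ≡⟨ cong₂ _∷_ (trans (ℤP.+-identityʳ _) (ℤP.*-identityʳ (c zero)))
                 (cong₂ _+ᵥ_ (trans (scale-ι (c zero) 0ᵥ) (⊙-zeroʳ _)) (lincomb-basis (c ∘ suc))) ⟩
  c zero ∷ (0ᵥ +ᵥ V.tabulate (c ∘ suc))
    ≡⟨ cong (c zero ∷_) (+ᵥ-identityˡ _) ⟩
  V.tabulate c ∎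
  where open ≡-Reasoning

box : ∀ {k} → (Fin k → ℕ) → List (Zd k)
box {zero} D = [] ∷ []
box {suc k} D = L.cartesianProductWith (λ a v → + a ∷ v) (L.upTo (D zero)) (box (D ∘ suc))

∈-box : ∀ {k} (D : Fin k → ℕ) (a : Fin k → ℕ) → (∀ j → a j ℕ.< D j) → V.tabulate (λ j → + a j) ∈ box D
∈-box {zero} D a h = here refl
∈-box {suc k} D a h =
  MP.∈-cartesianProductWith⁺ (λ a v → + a ∷ v) (MP.∈-upTo⁺ (h zero)) (∈-box (D ∘ suc) (a ∘ suc) (h ∘ suc))

-ᵥ-lincomb-basis : ∀ {k} (x y : Zd k) → x -ᵥ y ≡ lincomb basis (λ j → V.lookup x j - V.lookup y j)
-ᵥ-lincomb-basis x y = begin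
  x -ᵥ y                                       ≡⟨ sym (VP.tabulate∘lookup _) ⟩
  V.tabulate (V.lookup (x -ᵥ y))               ≡⟨ VP.tabulate-cong (λ j → VP.lookup-zipWith _-_ j x y) ⟩
  V.tabulate (λ j → V.lookup x j - V.lookup y j) ≡⟨ sym (lincomb-basis _) ⟩
  lincomb basis (λ j → V.lookup x j - V.lookup y j) ∎
  where open ≡-Reasoning

a-a%ℕn≡[a/ℕn]*n : ∀ a n .{{_ : ℕ.NonZero n}} → a - + (a ℤ.%ℕ n) ≡ (a ℤ./ℕ n) * + n
a-a%ℕn≡[a/ℕn]*n a n = begin
  a - r             ≡⟨ cong (_- r) (ℤD.a≡a%ℕn+[a/ℕn]*n a n) ⟩
  (r + q * + n) - r ≡⟨ ℤ+-xyx⁻¹≈y r (q * + n) ⟩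
  q * + n           ∎
  where
  open ≡-Reasoning
  r q : ℤ
  r = + (a ℤ.%ℕ n)
  q = a ℤ./ℕ n

module Lattice {d : ℕ} (u : Fin d → Zd d) where
  open Periods u

  InL-0 : InL 0ᵥ
  InL-0 = (λ _ → + 0) , sym (lincomb-zero u)

  InL-+ : ∀ {x y} → InL x → InL y → InL (x +ᵥ y)
  InL-+ (a , refl) (b , refl) = (λ i → a i + b i) , sym (lincomb-+ u a b)

  InL-neg : ∀ {x} → InL x → InL (negᵥ x)
  InL-neg (a , refl) = (λ i → - a i) , sym (lincomb-neg u a)

  InL-⊙ : ∀ {x} k → InL x → InL (ι k ⊙ x)
  InL-⊙ k (a , refl) = (λ i → k * a i) , sym (lincomb-* u k a)

  InL-lincomb : ∀ {k} (v : Fin k → Zd d) c → (∀ j → InL (scale (c j) (v j))) → InL (lincomb v c)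
  InL-lincomb {zero} v c h = InL-0
  InL-lincomb {suc k} v c h = InL-+ (h zero) (InL-lincomb (v ∘ suc) (c ∘ suc) (h ∘ suc))

  InP-+ : ∀ {x y} → InP x → InP y → InP (x +ᵥ y)
  InP-+ (a , refl) (b , refl) = (λ i → a i ℕ.+ b i) , sym (lincomb-+ u (λ i → + a i) (λ i → + b i))

  InP⇒InL : ∀ {x} → InP x → InL x
  InP⇒InL (c , e) = (λ i → + c i) , e

  ≡L-elim : ∀ {x y} → x ≡L y → InL (x +ᵥ negᵥ y)
  ≡L-elim {x} {y} = subst InL (-ᵥ-+negᵥ x y)

  ≡L-by : ∀ {x y} e → x +ᵥ negᵥ y ≡ e → InL e → x ≡L y
  ≡L-by {x} {y} e eq = subst InL (sym (trans (-ᵥ-+negᵥ x y) eq))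

  ≡L-refl : ∀ {x} → x ≡L x
  ≡L-refl {x} = ≡L-by 0ᵥ (+ᵥ-inverseʳ x) InL-0

  ≡⇒≡L : ∀ {x y} → x ≡ y → x ≡L y
  ≡⇒≡L refl = ≡L-refl

  ≡L-sym : ∀ {x y} → x ≡L y → y ≡L x
  ≡L-sym {x} {y} h =
    ≡L-by _ (solve 2 (λ x y → y :+ (:- x) := :- (x :+ (:- y))) refl x y) (InL-neg (≡L-elim h))

  ≡L-trans : ∀ {x y z} → x ≡L y → y ≡L z → x ≡L z
  ≡L-trans {x} {y} {z} h h′ =
    ≡L-by _ (solve 3 (λ x y z → x :+ (:- z) := (x :+ (:- y)) :+ (y :+ (:- z))) refl x y z)
          (InL-+ (≡L-elim h) (≡L-elim h′))

  ≡L-+ : ∀ {a b c e} → a ≡L b → c ≡L e → (a +ᵥ c) ≡L (b +ᵥ e)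
  ≡L-+ {a} {b} {c} {e} h h′ =
    ≡L-by _ (solve 4 (λ a b c e → (a :+ c) :+ (:- (b :+ e)) := (a :+ (:- b)) :+ (c :+ (:- e))) refl a b c e)
          (InL-+ (≡L-elim h) (≡L-elim h′))

  ≡L-cancelʳ : ∀ {a b c} → (a +ᵥ c) ≡L (b +ᵥ c) → a ≡L b
  ≡L-cancelʳ {a} {b} {c} h =
    ≡L-by _ (solve 3 (λ a b c → a :+ (:- b) := (a :+ c) :+ (:- (b :+ c))) refl a b c) (≡L-elim h)

  ≡L-cancelˡ : ∀ {a b c} → (c +ᵥ a) ≡L (c +ᵥ b) → a ≡L b
  ≡L-cancelˡ {a} {b} {c} h =
    ≡L-by _ (solve 3 (λ a b c → a :+ (:- b) := (c :+ a) :+ (:- (c :+ b))) refl a b c) (≡L-elim h)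

  +InL-≡L : ∀ {x ℓ} → InL ℓ → (x +ᵥ ℓ) ≡L x
  +InL-≡L {x} {ℓ} = ≡L-by ℓ (solve 2 (λ x ℓ → (x :+ ℓ) :+ (:- x) := ℓ) refl x ℓ)

  ≡L-setoid : Setoid 0ℓ 0ℓ
  ≡L-setoid = record
    { Carrier = Zd d ; _≈_ = _≡L_
    ; isEquivalence = record { refl = ≡L-refl ; sym = ≡L-sym ; trans = ≡L-trans } }

  diagonal : ℕ → Zd d
  diagonal N = lincomb u (λ _ → + N)

  InP-diagonal : ∀ N → InP (diagonal N)
  InP-diagonal N = (λ _ → N) , refl

  ∥_∥₁ : ∀ {k} → (Fin k → ℤ) → ℕ
  ∥_∥₁ {zero} c = 0
  ∥_∥₁ {suc k} c = ℤ.∣ c zero ∣ ℕ.+ ∥ c ∘ suc ∥₁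

  ∣c∣≤∥c∥₁ : ∀ {k} (c : Fin k → ℤ) i → ℤ.∣ c i ∣ ℕ.≤ ∥ c ∥₁
  ∣c∣≤∥c∥₁ {suc k} c zero = ℕP.m≤m+n _ _
  ∣c∣≤∥c∥₁ {suc k} c (suc i) = ℕP.≤-trans (∣c∣≤∥c∥₁ (c ∘ suc) i) (ℕP.m≤n+m _ _)

  shift-nonneg : ∀ (x : ℤ) N → ℤ.∣ x ∣ ℕ.≤ N → Σ ℕ λ n → + n ≡ x + + N
  shift-nonneg (+ m) N _ = m ℕ.+ N , refl
  shift-nonneg -[1+ m ] N h = N ℕ.∸ suc m , sym (ℤP.⊖-≥ h)

  InL⇒InP+diagonal : ∀ {ℓ} → InL ℓ → ∃[ N₀ ] ∀ N → N₀ ℕ.≤ N → InP (ℓ +ᵥ diagonal N)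
  InL⇒InP+diagonal (c , refl) = ∥ c ∥₁ , λ N N₀≤N →
    let shifted i = shift-nonneg (c i) N (ℕP.≤-trans (∣c∣≤∥c∥₁ c i) N₀≤N) in
    (λ i → proj₁ (shifted i)) ,
    sym (trans (lincomb-cong u (λ i → proj₂ (shifted i))) (lincomb-+ u c (λ _ → + N)))

module Independent {d : ℕ} (u : Fin d → Zd d) (li : LinIndep u) where
  open Periods u
  open Lattice u

  lincomb-injective : ∀ a b → lincomb u a ≡ lincomb u b → ∀ i → a i ≡ b i
  lincomb-injective a b e i = ℤP.i-j≡0⇒i≡j (a i) (b i) (li (λ j → a j - b j) a-b≡0 i)
    where
    a-b≡0 : lincomb u (λ j → a j - b j) ≡ 0ᵥ
    a-b≡0 = begin
      lincomb u (λ j → a j - b j)         ≡⟨ lincomb-+ u a (λ j → - b j) ⟩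
      lincomb u a +ᵥ lincomb u (λ j → - b j) ≡⟨ cong₂ _+ᵥ_ e (lincomb-neg u b) ⟩
      lincomb u b +ᵥ negᵥ (lincomb u b)   ≡⟨ +ᵥ-inverseʳ _ ⟩
      0ᵥ                                  ∎
      where open ≡-Reasoning

  x+[diagonal1+p]≢x : 1 ℕ.≤ d → ∀ {x p} → InP p → ¬ x +ᵥ (diagonal 1 +ᵥ p) ≡ x
  x+[diagonal1+p]≢x 1≤d {x} (c , refl) e =
    ℕP.1+n≢0 (ℤP.+-injective (lincomb-injective (λ j → + suc (c j)) (λ _ → + 0) shifted≡0 (fromℕ< 1≤d)))
    where
    shifted≡0 : lincomb u (λ j → + suc (c j)) ≡ lincomb u (λ _ → + 0)
    shifted≡0 = begin
      lincomb u (λ j → + 1 + + c j)             ≡⟨ lincomb-+ u (λ _ → + 1) (λ j → + c j) ⟩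
      diagonal 1 +ᵥ lincomb u (λ j → + c j)     ≡⟨ +ᵥ-cancelˡ (trans e (sym (+ᵥ-identityʳ x))) ⟩
      0ᵥ                                        ≡⟨ sym (lincomb-zero u) ⟩
      lincomb u (λ _ → + 0)                     ∎
      where open ≡-Reasoning

module FiniteIndex {d : ℕ} (u : Fin d → Zd d) (li : LinIndep u) where
  open Periods u
  open Lattice u

  InL-∣scale∣ : ∀ c {x} → InL (scale c x) → InL (scale (+ ℤ.∣ c ∣) x)
  InL-∣scale∣ (+ n) h = h
  InL-∣scale∣ -[1+ n ] {x} h = subst InL (sym eq) (InL-neg h)
    where
    eq : scale (+ suc n) x ≡ negᵥ (scale -[1+ n ] x)
    eq = begin
      scale (+ suc n) x           ≡⟨ trans (scale-ι _ x) (cong (_⊙ x) (ι-neg -[1+ n ])) ⟩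
      negᵥ (ι -[1+ n ]) ⊙ x        ≡⟨ solve 2 (λ c x → (:- c) :* x := :- (c :* x)) refl (ι -[1+ n ]) x ⟩
      negᵥ (ι -[1+ n ] ⊙ x)        ≡⟨ cong negᵥ (sym (scale-ι _ x)) ⟩
      negᵥ (scale -[1+ n ] x)      ∎
      where open ≡-Reasoning

  -- The d + 1 vectors eⱼ, u₁, …, u_d are dependent, and independence of the uᵢ forces a
  -- nonzero coefficient at eⱼ.
  basis-multiple-InL : ∀ j → ∃[ D ] InL (scale (+ suc D) (basis j))
  basis-multiple-InL j with dependent (ℕP.n<1+n d) (basis j VF.∷ u)
  ... | c , (i , ci≢0) , e = multiple ℤ.∣ c zero ∣ refl
    where
    b rest : Zd d
    b = basis j
    rest = lincomb u (c ∘ suc)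
    c₀b≡-rest : scale (c zero) b ≡ negᵥ rest
    c₀b≡-rest = begin
      scale (c zero) b                              ≡⟨ solve 2 (λ x y → x := (x :+ y) :+ :- y) refl _ rest ⟩
      (scale (c zero) b +ᵥ rest) +ᵥ negᵥ rest       ≡⟨ cong (_+ᵥ negᵥ rest) e ⟩
      0ᵥ +ᵥ negᵥ rest                               ≡⟨ +ᵥ-identityˡ _ ⟩
      negᵥ rest                                     ∎
      where open ≡-Reasoning
    c₀≢0 : ∀ i → ¬ c i ≡ + 0 → ¬ c zero ≡ + 0
    c₀≢0 zero ci≢0 c₀≡0 = ci≢0 c₀≡0
    c₀≢0 (suc i) ci≢0 c₀≡0 = ci≢0 (li (c ∘ suc) rest≡0 i)
      where
      rest≡0 : rest ≡ 0ᵥ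
      rest≡0 = trans (sym (+ᵥ-identityˡ rest))
                     (trans (cong (_+ᵥ rest) (sym (trans (cong (λ t → scale t b) c₀≡0) (scale-zero b)))) e)
    multiple : ∀ m → ℤ.∣ c zero ∣ ≡ m → ∃[ D ] InL (scale (+ suc D) b)
    multiple zero ∣c₀∣≡0 = ⊥-elim (c₀≢0 i ci≢0 (ℤP.∣i∣≡0⇒i≡0 ∣c₀∣≡0))
    multiple (suc D) ∣c₀∣≡1+D =
      D , subst (λ m → InL (scale (+ m) b)) ∣c₀∣≡1+D
                (InL-∣scale∣ (c zero) (subst InL (sym c₀b≡-rest) (InL-neg ((c ∘ suc) , refl))))

  modulus : Fin d → ℕ
  modulus j = suc (proj₁ (basis-multiple-InL j))

  reduce : Zd d → Zd d
  reduce z = V.tabulate (λ j → + (V.lookup z j ℤ.%ℕ modulus j))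

  reduce∈box : ∀ z → reduce z ∈ box modulus
  reduce∈box z = ∈-box modulus _ (λ j → ℤD.n%ℕd<d (V.lookup z j) (modulus j))

  z≡Lreduce : ∀ z → z ≡L reduce z
  z≡Lreduce z = subst InL (sym (-ᵥ-lincomb-basis z (reduce z))) (InL-lincomb basis (λ j → V.lookup z j - V.lookup (reduce z) j) term∈L)
    where
    term∈L : ∀ j → InL (scale (V.lookup z j - V.lookup (reduce z) j) (basis j))
    term∈L j = subst InL (sym term≡) (InL-⊙ (V.lookup z j ℤ./ℕ modulus j) (proj₂ (basis-multiple-InL j)))
      where
      open ≡-Reasoning
      term≡ : scale (V.lookup z j - V.lookup (reduce z) j) (basis j) ≡
              ι (V.lookup z j ℤ./ℕ modulus j) ⊙ scale (+ modulus j) (basis j)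
      term≡ = begin
        scale (V.lookup z j - V.lookup (reduce z) j) (basis j)
          ≡⟨ cong (λ t → scale (V.lookup z j - t) (basis j)) (VP.lookup∘tabulate _ j) ⟩
        scale (V.lookup z j - + (V.lookup z j ℤ.%ℕ modulus j)) (basis j)
          ≡⟨ cong (λ t → scale t (basis j)) (a-a%ℕn≡[a/ℕn]*n (V.lookup z j) (modulus j)) ⟩
        scale ((V.lookup z j ℤ./ℕ modulus j) * + modulus j) (basis j)
          ≡⟨ scale-* _ _ (basis j) ⟩
        ι (V.lookup z j ℤ./ℕ modulus j) ⊙ scale (+ modulus j) (basis j) ∎

  finite-quotient : ∃[ reps ] ∀ z → ∃[ r ] (r ∈ reps × z ≡L r)
  finite-quotient = box modulus , λ z → reduce z , reduce∈box z , z≡Lreduce z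

module Classical (em : ExcludedMiddle 0ℓ) where

  dne : {P : Set} → ¬ ¬ P → P
  dne = em⇒dne em

  Unbounded : (ℕ → Set) → Set
  Unbounded Q = ∀ B → ∃[ N ] (B ℕ.≤ N × Q N)

  pigeonhole : ∀ {A : Set} (G : List A) (Q : ℕ → A → Set) → (∀ N → ∃[ f ] (f ∈ G × Q N f)) →
               ∃[ f ] (f ∈ G × Unbounded (λ N → Q N f))
  pigeonhole [] Q h with h 0
  ... | _ , () , _
  pigeonhole (x ∷ G) Q h with em {Unbounded (λ N → Q N x)}
  ... | yes x-unbounded = x , here refl , x-unbounded
  ... | no x-bounded = let (f , f∈G , f-unbounded) = pigeonhole G (λ N → Q (N ℕ.+ B₀)) h′ in
                       f , there f∈G , shift f-unbounded
    where
    bound : ∃[ B₀ ] ∀ N → B₀ ℕ.≤ N → ¬ Q N x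
    bound = dne λ ¬bound → x-bounded λ B → dne λ ¬above → ¬bound (B , λ N B≤N q → ¬above (N , B≤N , q))
    B₀ : ℕ
    B₀ = proj₁ bound
    h′ : ∀ N → ∃[ f ] (f ∈ G × Q (N ℕ.+ B₀) f)
    h′ N with h (N ℕ.+ B₀)
    ... | f , here refl , q = ⊥-elim (proj₂ bound (N ℕ.+ B₀) (ℕP.m≤n+m B₀ N) q)
    ... | f , there f∈G , q = f , f∈G , q
    shift : ∀ {f} → Unbounded (λ N → Q (N ℕ.+ B₀) f) → Unbounded (λ N → Q N f)
    shift unb B = let (N , B≤N , q) = unb B in N ℕ.+ B₀ , ℕP.≤-trans B≤N (ℕP.m≤m+n N B₀) , q

  module Selection (S : Setoid 0ℓ 0ℓ) (Keep : Setoid.Carrier S → Set) where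
    open Setoid S using (_≈_) renaming (Carrier to A; refl to ≈-refl; sym to ≈-sym)

    Transversal : List A → List A → Set
    Transversal R 𝓜 = (∀ m → m ∈ 𝓜 → Keep m) × (∀ m m′ → m ∈ 𝓜 → m′ ∈ 𝓜 → m ≈ m′ → m ≡ m′) ×
                      (∀ r → r ∈ R → Keep r → ∃[ m ] (m ∈ 𝓜 × r ≈ m))

    transversal : ∀ R → ∃[ 𝓜 ] Transversal R 𝓜
    transversal [] = [] , (λ _ ()) , (λ _ _ ()) , (λ _ ())
    transversal (r ∷ R) with transversal R
    ... | 𝓜 , keep , inj , cover with em {∃[ m ] (m ∈ 𝓜 × r ≈ m)} | em {Keep r}
    ...   | yes r≈m | _ = 𝓜 , keep , inj , cover′
      where
      cover′ : ∀ r₁ → r₁ ∈ r ∷ R → Keep r₁ → ∃[ m ] (m ∈ 𝓜 × r₁ ≈ m)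
      cover′ r₁ (here refl) _ = r≈m
      cover′ r₁ (there r₁∈R) = cover r₁ r₁∈R
    ...   | no _ | no ¬keep = 𝓜 , keep , inj , cover′
      where
      cover′ : ∀ r₁ → r₁ ∈ r ∷ R → Keep r₁ → ∃[ m ] (m ∈ 𝓜 × r₁ ≈ m)
      cover′ r₁ (here refl) keep-r = ⊥-elim (¬keep keep-r)
      cover′ r₁ (there r₁∈R) = cover r₁ r₁∈R
    ...   | no r≉𝓜 | yes keep-r = r ∷ 𝓜 , keep′ , inj′ , cover′
      where
      keep′ : ∀ m → m ∈ r ∷ 𝓜 → Keep m
      keep′ m (here refl) = keep-r
      keep′ m (there m∈𝓜) = keep m m∈𝓜
      inj′ : ∀ m m′ → m ∈ r ∷ 𝓜 → m′ ∈ r ∷ 𝓜 → m ≈ m′ → m ≡ m′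
      inj′ m m′ (here refl) (here refl) _ = refl
      inj′ m m′ (here refl) (there m′∈𝓜) r≈m′ = ⊥-elim (r≉𝓜 (m′ , m′∈𝓜 , r≈m′))
      inj′ m m′ (there m∈𝓜) (here refl) m≈r = ⊥-elim (r≉𝓜 (m , m∈𝓜 , ≈-sym m≈r))
      inj′ m m′ (there m∈𝓜) (there m′∈𝓜) = inj m m′ m∈𝓜 m′∈𝓜
      cover′ : ∀ r₁ → r₁ ∈ r ∷ R → Keep r₁ → ∃[ m ] (m ∈ r ∷ 𝓜 × r₁ ≈ m)
      cover′ r₁ (here refl) _ = r , here refl , ≈-refl
      cover′ r₁ (there r₁∈R) keep-r₁ = let (m , m∈𝓜 , r₁≈m) = cover r₁ r₁∈R keep-r₁ in m , there m∈𝓜 , r₁≈m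

module ℕ∑ = CommutativeMonoidSum ℕP.+-0-commutativeMonoid

module EventuallyPeriodicSet (em : ExcludedMiddle 0ℓ) {d : ℕ} (u : Fin d → Zd d) (li : LinIndep u)
                 (W : Subset d) (F : List (Zd d))
                 (W⊆F+P : ∀ x → W x → ∃[ f ] ∃[ p ] (f ∈ F × Periods.InP u p × x ≡ f +ᵥ p)) where
  open Periods u
  open Lattice u
  open Independent u li
  open Classical em

  WGood⇒TranslateP⊆ : ∀ {v} → WGood W v → TranslateP⊆ v W
  WGood⇒TranslateP⊆ (Wv , ¬scr) = dne λ ¬translate → ¬scr (Wv , ¬translate)

  WGood-+InP : ∀ {v q} → WGood W v → InP q → WGood W (v +ᵥ q)
  WGood-+InP {v} {q} good q∈P = v+P⊆W q q∈P , λ (_ , ¬translate) → ¬translate λ p p∈P →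
    subst W (sym (+ᵥ-assoc v q p)) (v+P⊆W (q +ᵥ p) (InP-+ q∈P p∈P))
    where
    v+P⊆W : TranslateP⊆ v W
    v+P⊆W = WGood⇒TranslateP⊆ good

  W-covered : ∀ {v} → WCal∪WScr₁ W v → W v
  W-covered (inj₁ cal) = proj₁ (proj₁ cal)
  W-covered (inj₂ scr₁) = proj₁ (proj₁ scr₁)

  ℕcomb : (Fin d → ℕ) → Zd d
  ℕcomb e = lincomb u (λ i → + e i)

  ℕcomb-+ : ∀ a b → ℕcomb (λ i → a i ℕ.+ b i) ≡ ℕcomb a +ᵥ ℕcomb b
  ℕcomb-+ a b = lincomb-+ u (λ i → + a i) (λ i → + b i)

  sum≡0⇒≡0 : ∀ {k} (a : Fin k → ℕ) → ℕ∑.sum a ≡ 0 → ∀ i → a i ≡ 0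
  sum≡0⇒≡0 {suc k} a h zero = ℕP.m+n≡0⇒m≡0 (a zero) h
  sum≡0⇒≡0 {suc k} a h (suc i) = sum≡0⇒≡0 (a ∘ suc) (ℕP.m+n≡0⇒n≡0 (a zero) h) i

  height-bound-over : ∀ w (G : List (Zd d)) →
                      ∃[ B ] ∀ {f} g → f ∈ G → f +ᵥ ℕcomb g ≡ w → ℕ∑.sum g ℕ.≤ B
  height-bound-over w [] = 0 , λ _ ()
  height-bound-over w (f₀ ∷ G) with height-bound-over w G | em {∃[ g₀ ] f₀ +ᵥ ℕcomb g₀ ≡ w}
  ... | B , bounded | yes (g₀ , f₀+g₀≡w) = ℕ∑.sum g₀ ℕ.+ B , bounded′
    where
    bounded′ : ∀ {f} g → f ∈ f₀ ∷ G → f +ᵥ ℕcomb g ≡ w → ℕ∑.sum g ℕ.≤ ℕ∑.sum g₀ ℕ.+ B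
    bounded′ g (here refl) f₀+g≡w = ℕP.≤-trans (ℕP.≤-reflexive (ℕ∑.sum-cong-≗ g≗g₀)) (ℕP.m≤m+n _ _)
      where
      g≗g₀ : ∀ i → g i ≡ g₀ i
      g≗g₀ i = ℤP.+-injective (lincomb-injective (λ j → + g j) (λ j → + g₀ j) (+ᵥ-cancelˡ (trans f₀+g≡w (sym f₀+g₀≡w))) i)
    bounded′ g (there f∈G) f+g≡w = ℕP.≤-trans (bounded g f∈G f+g≡w) (ℕP.m≤n+m _ _)
  ... | B , bounded | no ∄g₀ = B , bounded′
    where
    bounded′ : ∀ {f} g → f ∈ f₀ ∷ G → f +ᵥ ℕcomb g ≡ w → ℕ∑.sum g ℕ.≤ B
    bounded′ g (here refl) f₀+g≡w = ⊥-elim (∄g₀ (g , f₀+g≡w))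
    bounded′ g (there f∈G) = bounded g f∈G

  height-bound : ∀ w → ∃[ B ] ∀ {x} e → W x → x +ᵥ ℕcomb e ≡ w → ℕ∑.sum e ℕ.≤ B
  height-bound w = B , bounded
    where
    B : ℕ
    B = proj₁ (height-bound-over w F)
    bounded : ∀ {x} e → W x → x +ᵥ ℕcomb e ≡ w → ℕ∑.sum e ℕ.≤ B
    bounded {x} e Wx x+e≡w with W⊆F+P x Wx
    ... | f , p , f∈F , (c , refl) , refl = begin
      ℕ∑.sum e                          ≤⟨ ℕP.m≤n+m _ _ ⟩
      ℕ∑.sum c ℕ.+ ℕ∑.sum e             ≡⟨ ℕ∑.∑-distrib-+ c e ⟨
      ℕ∑.sum (λ i → c i ℕ.+ e i)        ≤⟨ proj₂ (height-bound-over w F) _ f∈F f+c+e≡w ⟩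
      B                                 ∎
      where
      open ℕP.≤-Reasoning
      f+c+e≡w : f +ᵥ ℕcomb (λ i → c i ℕ.+ e i) ≡ w
      f+c+e≡w = trans (cong (f +ᵥ_) (ℕcomb-+ c e)) (trans (sym (+ᵥ-assoc f (ℕcomb c) (ℕcomb e))) x+e≡w)

  ¬WCal⇒lower : ∀ {x} → WGood W x → ¬ WCal W x →
                ∃[ y ] ∃[ p ] (InP p × y ≡ x -ᵥ p × WGood W y × ¬ y ≡ x)
  ¬WCal⇒lower good ¬cal =
    dne λ ∄y → ¬cal (good , λ y (p , p∈P , y≡x-p) good-y → dne λ y≢x → ∄y (y , p , p∈P , y≡x-p , good-y , y≢x))

  -- The height ∑ e of x below w (x + ℕcomb e = w) grows strictly along the descent and is
  -- bounded, because x lies above some f ∈ F and w − f has unique coefficients.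
  module Descent (w : Zd d) where
    B : ℕ
    B = proj₁ (height-bound w)

    descend : ∀ fuel {x} e → WGood W x → x +ᵥ ℕcomb e ≡ w → B ℕ.∸ ℕ∑.sum e ℕ.≤ fuel →
              ∃[ v ] (WCal W v × w ≡L v)
    descend fuel {x} e good x+e≡w fuel-enough with em {WCal W x}
    ... | yes cal = x , cal , subst (_≡L x) x+e≡w (+InL-≡L (InP⇒InL (e , refl)))
    ... | no ¬cal with ¬WCal⇒lower good ¬cal
    ... | y , p , (c , refl) , y≡x-c , good-y , y≢x = step fuel fuel-enough
      where
      open ≡-Reasoning
      e′ : Fin d → ℕ
      e′ i = e i ℕ.+ c i
      y+e′≡w : y +ᵥ ℕcomb e′ ≡ w
      y+e′≡w = begin
        y +ᵥ ℕcomb e′                              ≡⟨ cong₂ _+ᵥ_ (trans y≡x-c (-ᵥ-+negᵥ x (ℕcomb c))) (ℕcomb-+ e c) ⟩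
        (x +ᵥ negᵥ (ℕcomb c)) +ᵥ (ℕcomb e +ᵥ ℕcomb c) ≡⟨ solve 3 (λ x a b → (x :+ :- b) :+ (a :+ b) := x :+ a) refl x (ℕcomb e) (ℕcomb c) ⟩
        x +ᵥ ℕcomb e                               ≡⟨ x+e≡w ⟩
        w                                          ∎
      c≢0 : ¬ ℕ∑.sum c ≡ 0
      c≢0 sum≡0 = y≢x (begin
        y                       ≡⟨ trans y≡x-c (-ᵥ-+negᵥ x (ℕcomb c)) ⟩
        x +ᵥ negᵥ (ℕcomb c)     ≡⟨ cong (λ t → x +ᵥ negᵥ t) (trans (lincomb-cong u (cong +_ ∘ sum≡0⇒≡0 c sum≡0)) (lincomb-zero u)) ⟩
        x +ᵥ negᵥ 0ᵥ            ≡⟨ cong (x +ᵥ_) negᵥ-0ᵥ ⟩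
        x +ᵥ 0ᵥ                 ≡⟨ +ᵥ-identityʳ x ⟩
        x                       ∎)
      height-increases : ℕ∑.sum e ℕ.< ℕ∑.sum e′
      height-increases = ℕP.<-≤-trans (ℕP.m<m+n (ℕ∑.sum e) (ℕP.n≢0⇒n>0 c≢0)) (ℕP.≤-reflexive (sym (ℕ∑.∑-distrib-+ e c)))
      height-bounded : ℕ∑.sum e′ ℕ.≤ B
      height-bounded = proj₂ (height-bound w) e′ (proj₁ good-y) y+e′≡w
      step : ∀ fuel → B ℕ.∸ ℕ∑.sum e ℕ.≤ fuel → ∃[ v ] (WCal W v × w ≡L v)
      step zero out-of-fuel = ⊥-elim (ℕP.<-irrefl refl (ℕP.<-≤-trans height-increases
        (ℕP.≤-trans height-bounded (ℕP.m∸n≡0⇒m≤n (ℕP.n≤0⇒n≡0 out-of-fuel)))))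
      step (suc fuel) h = descend fuel e′ good-y y+e′≡w
        (ℕP.≤-pred (ℕP.<-≤-trans (ℕP.∸-monoʳ-< height-increases height-bounded) h))

  WGood⇒≡L-WCal : ∀ {w} → WGood W w → ∃[ v ] (WCal W v × w ≡L v)
  WGood⇒≡L-WCal {w} good = Descent.descend w (Descent.B w) (λ _ → 0) good
    (trans (cong (w +ᵥ_) (lincomb-zero u)) (+ᵥ-identityʳ w)) (ℕP.m∸n≤m (Descent.B w) (ℕ∑.sum {d} (λ _ → 0)))

  W-classification : ∀ {x} → W x → WScr₁ W x ⊎ ∃[ v ] (WCal W v × x ≡L v)
  W-classification {x} Wx with em {∃[ v ] (WCal W v × x ≡L v)} | em {WScr W x}
  ... | yes ≡L-cal | _ = inj₂ ≡L-cal
  ... | no ∄cal | yes scr = inj₁ (scr , λ v cal x≡Lv → ∄cal (v , cal , x≡Lv))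
  ... | no ∄cal | no ¬scr = ⊥-elim (∄cal (WGood⇒≡L-WCal (Wx , ¬scr)))

  W-representative : ∀ {x} → W x → ∃[ w ] (WCal∪WScr₁ W w × x ≡L w)
  W-representative Wx with W-classification Wx
  ... | inj₁ scr₁ = _ , inj₂ scr₁ , ≡L-refl
  ... | inj₂ (v , cal , x≡Lv) = v , inj₁ cal , x≡Lv

module MinimalComplements (em : ExcludedMiddle 0ℓ) {d : ℕ} (u : Fin d → Zd d) (li : LinIndep u) (1≤d : 1 ℕ.≤ d)
       (W : Subset d) (F : List (Zd d))
       (W⊆F+P : ∀ x → W x → ∃[ f ] ∃[ p ] (f ∈ F × Periods.InP u p × x ≡ f +ᵥ p))
       (w₀ : Zd d) (WScr₁≡w₀ : ∀ w → Periods.WScr₁ u W w ⇔ (w ≡ w₀)) where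
  open Periods u
  open Lattice u
  open Independent u li
  open Classical em
  open EventuallyPeriodicSet em u li W F W⊆F+P

  WScr₁⇒≡w₀ : ∀ {w} → WScr₁ W w → w ≡ w₀
  WScr₁⇒≡w₀ {w} = Equivalence.to (WScr₁≡w₀ w)

  _≟ᵥ_ : (x y : Zd d) → Dec (x ≡ y)
  _≟ᵥ_ = VP.≡-dec ℤ._≟_

  preimage : List (Zd d) → Subset d
  preimage 𝓜 x = ∃[ m ] (m ∈ 𝓜 × x ≡L m)

  preimage-isComplement : ∀ 𝓜 → Conditions W 𝓜 → IsComplement W (preimage 𝓜)
  preimage-isComplement 𝓜 ((m₀ , m₀∈𝓜) , _ , cover , _) = (m₀ , m₀ , m₀∈𝓜 , ≡L-refl) , decompose
    where
    decompose : ∀ z → ∃[ x ] ∃[ w ] (preimage 𝓜 x × W w × x +ᵥ w ≡ z)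
    decompose z with cover z
    ... | m , w , m∈𝓜 , w∈ , m+w≡Lz =
      z +ᵥ negᵥ w , w ,
      (m , m∈𝓜 , ≡L-by _ (solve 3 (λ z w m → (z :+ :- w) :+ :- m := :- ((m :+ w) :+ :- z)) refl z w m)
                        (InL-neg (≡L-elim m+w≡Lz))) ,
      W-covered w∈ , solve 2 (λ z w → (z :+ :- w) :+ w := z) refl z w

  preimage-minimal : ∀ 𝓜 → Conditions W 𝓜 →
                     ¬ (Σ (Subset d) λ M′ → M′ ⊆ preimage 𝓜 × (∃[ m ] (preimage 𝓜 m × ¬ M′ m)) × IsComplement W M′)
  preimage-minimal 𝓜 (_ , _ , _ , private-summand) (M′ , M′⊆ , (m₁ , (m , m∈𝓜 , m₁≡Lm) , m₁∉M′) , _ , cover′)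
    with private-summand m m∈𝓜
  ... | w , scr₁ , w-private with cover′ (m₁ +ᵥ w)
  ... | m₂ , w₂ , m₂∈M′ , Ww₂ , m₂+w₂≡m₁+w with M′⊆ m₂∈M′
  ... | m′ , m′∈𝓜 , m₂≡Lm′ with m′ ≟ᵥ m
  ...   | no m′≢m =
    let (w″ , w″∈ , w₂≡Lw″) = W-representative Ww₂ in
    w-private m′ w″ m′∈𝓜 m′≢m w″∈ (begin
      m +ᵥ w     ≈⟨ ≡L-+ (≡L-sym m₁≡Lm) ≡L-refl ⟩
      m₁ +ᵥ w    ≡⟨ sym m₂+w₂≡m₁+w ⟩
      m₂ +ᵥ w₂   ≈⟨ ≡L-+ m₂≡Lm′ w₂≡Lw″ ⟩
      m′ +ᵥ w″   ∎)
    where open SetoidReasoning ≡L-setoid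
  ...   | yes refl with W-classification Ww₂
  ...     | inj₁ scr₁₂ = m₁∉M′ (subst M′ m₂≡m₁ m₂∈M′)
    where
    m₂≡m₁ : m₂ ≡ m₁
    m₂≡m₁ = +ᵥ-cancelʳ (trans m₂+w₂≡m₁+w (cong (m₁ +ᵥ_) (trans (WScr₁⇒≡w₀ scr₁) (sym (WScr₁⇒≡w₀ scr₁₂)))))
  ...     | inj₂ (v , cal , w₂≡Lv) = proj₂ scr₁ v cal (≡L-trans w≡Lw₂ w₂≡Lv)
    where
    w≡Lw₂ : w ≡L w₂
    w≡Lw₂ = ≡L-cancelˡ (begin
      m₁ +ᵥ w    ≡⟨ sym m₂+w₂≡m₁+w ⟩
      m₂ +ᵥ w₂   ≈⟨ ≡L-+ (≡L-trans m₂≡Lm′ (≡L-sym m₁≡Lm)) ≡L-refl ⟩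
      m₁ +ᵥ w₂   ∎)
      where open SetoidReasoning ≡L-setoid

  Conditions⇒HasMinimalComplement : (∃[ 𝓜 ] Conditions W 𝓜) → HasMinimalComplement W
  Conditions⇒HasMinimalComplement (𝓜 , conditions) =
    preimage 𝓜 , preimage-isComplement 𝓜 conditions , preimage-minimal 𝓜 conditions

  module Complement (M : Subset d) (M-complement : IsComplement W M) where

    Class⊆M+P : Zd d → Set
    Class⊆M+P y = ∀ x → x ≡L y → ∃[ m ] (M m × InP (x -ᵥ m))

    Class⊆M+P-resp : ∀ {y y′} → Class⊆M+P y → y ≡L y′ → Class⊆M+P y′
    Class⊆M+P-resp class⊆ y≡Ly′ x x≡Ly′ = class⊆ x (≡L-trans x≡Ly′ (≡L-sym y≡Ly′))

    Witness : Zd d → ℕ → Zd d → Set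
    Witness z N f = ∃[ m ] ∃[ w ] ∃[ p ] (M m × W w × InP p × m +ᵥ w ≡ z +ᵥ negᵥ (diagonal N) × w ≡ f +ᵥ p)

    witness : ∀ z N → ∃[ f ] (f ∈ F × Witness z N f)
    witness z N with proj₂ M-complement (z +ᵥ negᵥ (diagonal N))
    ... | m , w , Mm , Ww , m+w≡ with W⊆F+P w Ww
    ... | f , p , f∈F , p∈P , w≡f+p = f , f∈F , m , w , p , Mm , Ww , p∈P , m+w≡ , w≡f+p

    unbounded-witness⇒Class⊆M+P : ∀ {z f} → Unbounded (λ N → Witness z N f) → Class⊆M+P (z +ᵥ negᵥ f)
    unbounded-witness⇒Class⊆M+P {z} {f} unbounded x x≡L with InL⇒InP+diagonal (≡L-elim x≡L)
    ... | N₀ , large with unbounded N₀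
    ... | N , N₀≤N , m , w , p , Mm , _ , p∈P , m+w≡ , w≡f+p =
      m , Mm , subst InP (sym x-m≡) (InP-+ (large N N₀≤N) p∈P)
      where
      open ≡-Reasoning
      T : Zd d
      T = diagonal N
      z≡ : z ≡ (m +ᵥ (f +ᵥ p)) +ᵥ T
      z≡ = begin
        z                      ≡⟨ solve 2 (λ z t → z := (z :+ :- t) :+ t) refl z T ⟩
        (z +ᵥ negᵥ T) +ᵥ T     ≡⟨ cong (_+ᵥ T) (sym m+w≡) ⟩
        (m +ᵥ w) +ᵥ T          ≡⟨ cong (λ t → (m +ᵥ t) +ᵥ T) w≡f+p ⟩
        (m +ᵥ (f +ᵥ p)) +ᵥ T   ∎
      x-m≡ : x -ᵥ m ≡ ((x +ᵥ negᵥ (z +ᵥ negᵥ f)) +ᵥ T) +ᵥ p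
      x-m≡ = begin
        x -ᵥ m
          ≡⟨ -ᵥ-+negᵥ x m ⟩
        x +ᵥ negᵥ m
          ≡⟨ solve 5 (λ x m f p t → x :+ :- m := ((x :+ :- (((m :+ (f :+ p)) :+ t) :+ :- f)) :+ t) :+ p) refl x m f p T ⟩
        ((x +ᵥ negᵥ (((m +ᵥ (f +ᵥ p)) +ᵥ T) +ᵥ negᵥ f)) +ᵥ T) +ᵥ p
          ≡⟨ cong (λ t → ((x +ᵥ negᵥ (t +ᵥ negᵥ f)) +ᵥ T) +ᵥ p) (sym z≡) ⟩
        ((x +ᵥ negᵥ (z +ᵥ negᵥ f)) +ᵥ T) +ᵥ p ∎

    decomposition : ∀ z → ∃[ y ] ∃[ w ] (Class⊆M+P y × WCal∪WScr₁ W w × (y +ᵥ w) ≡L z)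
    decomposition z with pigeonhole F (Witness z) (witness z)
    ... | f , _ , unbounded with unbounded 0
    ... | _ , _ , _ , w , p , _ , Ww , p∈P , _ , w≡f+p with W-representative Ww
    ... | w′ , w′∈ , w≡Lw′ = z +ᵥ negᵥ f , w′ , unbounded-witness⇒Class⊆M+P unbounded , w′∈ , (begin
      (z +ᵥ negᵥ f) +ᵥ w′          ≈⟨ ≡L-+ ≡L-refl (≡L-sym w≡Lw′) ⟩
      (z +ᵥ negᵥ f) +ᵥ w           ≡⟨ cong ((z +ᵥ negᵥ f) +ᵥ_) w≡f+p ⟩
      (z +ᵥ negᵥ f) +ᵥ (f +ᵥ p)    ≈⟨ ≡L-+ ≡L-refl (+InL-≡L (InP⇒InL p∈P)) ⟩
      (z +ᵥ negᵥ f) +ᵥ f           ≡⟨ solve 2 (λ z f → (z :+ :- f) :+ f := z) refl z f ⟩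
      z                            ∎)
      where open SetoidReasoning ≡L-setoid

    decompose-above : ∀ {y v z} → Class⊆M+P y → z ≡L (y +ᵥ v) →
                      ∃[ m ] ∃[ p ] (M m × InP p × z ≡ m +ᵥ (v +ᵥ (diagonal 1 +ᵥ p)))
    decompose-above {y} {v} {z} class⊆ z≡Ly+v = lift (class⊆ x x≡Ly)
      where
      open ≡-Reasoning
      x : Zd d
      x = (z +ᵥ negᵥ v) +ᵥ negᵥ (diagonal 1)
      x≡Ly : x ≡L y
      x≡Ly = ≡L-by _ (solve 4 (λ z v t y → ((z :+ :- v) :+ :- t) :+ :- y := (z :+ :- (y :+ v)) :+ :- t) refl z v (diagonal 1) y)
                     (InL-+ (≡L-elim z≡Ly+v) (InL-neg (InP⇒InL (InP-diagonal 1))))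
      lift : ∃[ m ] (M m × InP (x -ᵥ m)) → ∃[ m ] ∃[ p ] (M m × InP p × z ≡ m +ᵥ (v +ᵥ (diagonal 1 +ᵥ p)))
      lift (m , Mm , x-m∈P) = m , x -ᵥ m , Mm , x-m∈P , (begin
        z
          ≡⟨ solve 4 (λ z v t m → z := m :+ (v :+ (t :+ (((z :+ :- v) :+ :- t) :+ :- m)))) refl z v (diagonal 1) m ⟩
        m +ᵥ (v +ᵥ (diagonal 1 +ᵥ (x +ᵥ negᵥ m)))
          ≡⟨ cong (λ t → m +ᵥ (v +ᵥ (diagonal 1 +ᵥ t))) (sym (-ᵥ-+negᵥ x m)) ⟩
        m +ᵥ (v +ᵥ (diagonal 1 +ᵥ (x -ᵥ m))) ∎)

    module Minimal (M-minimal : ¬ (Σ (Subset d) λ M′ → M′ ⊆ M × (∃[ m ] (M m × ¬ M′ m)) × IsComplement W M′)) where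

      WScr≢WGood+diagonal : ∀ {w v p} → WScr W w → WGood W v → InP p → ¬ w ≡ v +ᵥ (diagonal 1 +ᵥ p)
      WScr≢WGood+diagonal scr good p∈P w≡ =
        proj₂ (WGood-+InP good (InP-+ (InP-diagonal 1) p∈P)) (subst (WScr W) w≡ scr)

      module Collision {r r′ w′} (r⊆ : Class⊆M+P r) (r′⊆ : Class⊆M+P r′) (cal : WCal W w′)
                       (r+w₀≡Lr′+w′ : (r +ᵥ w₀) ≡L (r′ +ᵥ w′)) where

        m*-below : ∃[ m ] (M m × InP (r -ᵥ m))
        m*-below = r⊆ r ≡L-refl

        m* : Zd d
        m* = proj₁ m*-below

        m*≡Lr : m* ≡L r
        m*≡Lr = ≡L-sym (InP⇒InL (proj₂ (proj₂ m*-below)))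

        M∖m* : Subset d
        M∖m* x = M x × ¬ x ≡ m*

        nonempty : ∃[ m ] M∖m* m
        nonempty = below-m* (r⊆ (m* +ᵥ negᵥ (diagonal 1)) (≡L-trans (+InL-≡L (InL-neg (InP⇒InL (InP-diagonal 1)))) m*≡Lr))
          where
          below-m* : ∃[ m ] (M m × InP ((m* +ᵥ negᵥ (diagonal 1)) -ᵥ m)) → ∃[ m ] M∖m* m
          below-m* (m , Mm , p∈P) = m , Mm , λ m≡m* → x+[diagonal1+p]≢x 1≤d p∈P (begin
            m +ᵥ (diagonal 1 +ᵥ ((m* +ᵥ negᵥ (diagonal 1)) -ᵥ m))
              ≡⟨ cong (λ t → m +ᵥ (diagonal 1 +ᵥ t)) (-ᵥ-+negᵥ _ m) ⟩
            m +ᵥ (diagonal 1 +ᵥ ((m* +ᵥ negᵥ (diagonal 1)) +ᵥ negᵥ m))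
              ≡⟨ cong (λ t → m +ᵥ (diagonal 1 +ᵥ ((t +ᵥ negᵥ (diagonal 1)) +ᵥ negᵥ m))) (sym m≡m*) ⟩
            m +ᵥ (diagonal 1 +ᵥ ((m +ᵥ negᵥ (diagonal 1)) +ᵥ negᵥ m))
              ≡⟨ solve 2 (λ m t → m :+ (t :+ ((m :+ :- t) :+ :- m)) := m) refl m (diagonal 1) ⟩
            m ∎)
            where open ≡-Reasoning

        reroute : ∀ {z w₁ y v} → m* +ᵥ w₁ ≡ z → Class⊆M+P y → WGood W v → z ≡L (y +ᵥ v) →
                  (∀ {p} → InP p → ¬ w₁ ≡ v +ᵥ (diagonal 1 +ᵥ p)) → ∃[ m ] ∃[ w ] (M∖m* m × W w × m +ᵥ w ≡ z)
        reroute {z} {w₁} {y} {v} m*+w₁≡z y⊆ good z≡Ly+v w₁≢ = above (decompose-above y⊆ z≡Ly+v)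
          where
          above : ∃[ m ] ∃[ p ] (M m × InP p × z ≡ m +ᵥ (v +ᵥ (diagonal 1 +ᵥ p))) → ∃[ m ] ∃[ w ] (M∖m* m × W w × m +ᵥ w ≡ z)
          above (m , p , Mm , p∈P , z≡) =
            m , v +ᵥ (diagonal 1 +ᵥ p) , (Mm , m≢m*) , proj₁ (WGood-+InP good (InP-+ (InP-diagonal 1) p∈P)) , sym z≡
            where
            m≢m* : ¬ m ≡ m*
            m≢m* m≡m* = w₁≢ p∈P (+ᵥ-cancelˡ (trans m*+w₁≡z (trans z≡ (cong (_+ᵥ _) m≡m*))))

        z≡Lr+ : ∀ {z w₁ v} → m* +ᵥ w₁ ≡ z → w₁ ≡L v → z ≡L (r +ᵥ v)
        z≡Lr+ m*+w₁≡z w₁≡Lv = subst (_≡L _) m*+w₁≡z (≡L-+ m*≡Lr w₁≡Lv)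

        cover-at-m* : ∀ {z w₁} → W w₁ → m* +ᵥ w₁ ≡ z → ∃[ m ] ∃[ w ] (M∖m* m × W w × m +ᵥ w ≡ z)
        cover-at-m* {z} {w₁} Ww₁ m*+w₁≡z with em {WScr W w₁}
        ... | no ¬scr = reroute m*+w₁≡z r⊆ (Ww₁ , ¬scr) (z≡Lr+ m*+w₁≡z ≡L-refl)
                          (λ p∈P w₁≡ → x+[diagonal1+p]≢x 1≤d p∈P (sym w₁≡))
        ... | yes scr with W-classification Ww₁
        ...   | inj₂ (v , cal-v , w₁≡Lv) =
                reroute m*+w₁≡z r⊆ (proj₁ cal-v) (z≡Lr+ m*+w₁≡z w₁≡Lv) (WScr≢WGood+diagonal scr (proj₁ cal-v))
        ...   | inj₁ scr₁ =
                reroute m*+w₁≡z r′⊆ (proj₁ cal) (≡L-trans (z≡Lr+ m*+w₁≡z (≡⇒≡L (WScr₁⇒≡w₀ scr₁))) r+w₀≡Lr′+w′)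
                  (WScr≢WGood+diagonal scr (proj₁ cal))

        cover : ∀ z → ∃[ m ] ∃[ w ] (M∖m* m × W w × m +ᵥ w ≡ z)
        cover z with proj₂ M-complement z
        ... | m₁ , w₁ , Mm₁ , Ww₁ , m₁+w₁≡z with m₁ ≟ᵥ m*
        ...   | no m₁≢m* = m₁ , w₁ , (Mm₁ , m₁≢m*) , Ww₁ , m₁+w₁≡z
        ...   | yes m₁≡m* = cover-at-m* Ww₁ (trans (cong (_+ᵥ w₁) (sym m₁≡m*)) m₁+w₁≡z)

        contradiction : ⊥
        contradiction = M-minimal (M∖m* , proj₁ , (m* , proj₁ (proj₂ m*-below) , λ m*∈ → proj₂ m*∈ refl) , nonempty , cover)

      no-WCal-collision : ∀ {r r′ w′} → Class⊆M+P r → Class⊆M+P r′ → WCal W w′ → ¬ (r +ᵥ w₀) ≡L (r′ +ᵥ w′)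
      no-WCal-collision r⊆ r′⊆ cal r+w₀≡Lr′+w′ = Collision.contradiction r⊆ r′⊆ cal r+w₀≡Lr′+w′

      open FiniteIndex u li
      open Selection ≡L-setoid Class⊆M+P

      chosen : ∃[ 𝓜 ] Transversal (proj₁ finite-quotient) 𝓜
      chosen = transversal (proj₁ finite-quotient)

      𝓜 : List (Zd d)
      𝓜 = proj₁ chosen

      representative : ∀ {y} → Class⊆M+P y → ∃[ m ] (m ∈ 𝓜 × y ≡L m)
      representative {y} y⊆ =
        let (r , r∈reps , y≡Lr) = proj₂ finite-quotient y
            (m , m∈𝓜 , r≡Lm) = proj₂ (proj₂ (proj₂ chosen)) r r∈reps (Class⊆M+P-resp y⊆ y≡Lr)
        in m , m∈𝓜 , ≡L-trans y≡Lr r≡Lm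

      covering : ∀ z → ∃[ m ] ∃[ w ] (m ∈ 𝓜 × WCal∪WScr₁ W w × (m +ᵥ w) ≡L z)
      covering z =
        let (y , w , y⊆ , w∈ , y+w≡Lz) = decomposition z
            (m , m∈𝓜 , y≡Lm) = representative y⊆
        in m , w , m∈𝓜 , w∈ , ≡L-trans (≡L-+ (≡L-sym y≡Lm) ≡L-refl) y+w≡Lz

      nonempty : ∃[ m ] m ∈ 𝓜
      nonempty = let (m , _ , m∈𝓜 , _) = covering 0ᵥ in m , m∈𝓜

      private-summand : ∀ m → m ∈ 𝓜 → ∃[ w ] (WScr₁ W w ×
        (∀ m′ w′ → m′ ∈ 𝓜 → ¬ (m′ ≡ m) → WCal∪WScr₁ W w′ → ¬ ((m +ᵥ w) ≡L (m′ +ᵥ w′))))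
      private-summand m m∈𝓜 = w₀ , Equivalence.from (WScr₁≡w₀ w₀) refl , collision
        where
        keep : ∀ m → m ∈ 𝓜 → Class⊆M+P m
        keep = proj₁ (proj₂ chosen)
        injective : ∀ m m′ → m ∈ 𝓜 → m′ ∈ 𝓜 → m ≡L m′ → m ≡ m′
        injective = proj₁ (proj₂ (proj₂ chosen))
        collision : ∀ m′ w′ → m′ ∈ 𝓜 → ¬ (m′ ≡ m) → WCal∪WScr₁ W w′ → ¬ ((m +ᵥ w₀) ≡L (m′ +ᵥ w′))
        collision m′ w′ m′∈𝓜 m′≢m (inj₂ scr₁) m+w₀≡L = m′≢m (sym (injective m m′ m∈𝓜 m′∈𝓜
          (≡L-cancelʳ (subst (λ t → (m +ᵥ w₀) ≡L (m′ +ᵥ t)) (WScr₁⇒≡w₀ scr₁) m+w₀≡L))))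
        collision m′ w′ m′∈𝓜 m′≢m (inj₁ cal) = no-WCal-collision (keep m m∈𝓜) (keep m′ m′∈𝓜) cal

      conditions : Conditions W 𝓜
      conditions = nonempty , proj₁ (proj₂ (proj₂ chosen)) , covering , private-summand

  HasMinimalComplement⇒Conditions : HasMinimalComplement W → ∃[ 𝓜 ] Conditions W 𝓜
  HasMinimalComplement⇒Conditions (M , M-complement , M-minimal) =
    _ , Complement.Minimal.conditions M M-complement M-minimal

theorem4p23 : ExcludedMiddle 0ℓ → (d : ℕ) → d ≥ 1 → (u : Fin d → Zd d) → LinIndep u →
    (W : Subset d) → Periods.EventuallyPeriodic u W →
    (∃[ w₀ ] (∀ w → Periods.WScr₁ u W w ⇔ (w ≡ w₀))) →
    (Periods.HasMinimalComplement u W ⇔ (∃[ 𝓜 ] Periods.Conditions u W 𝓜))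
theorem4p23 em d 1≤d u li W (_ , (F , _ , W⊆F+P) , _) (w₀ , WScr₁≡w₀) =
  mk⇔ HasMinimalComplement⇒Conditions Conditions⇒HasMinimalComplement
  where open MinimalComplements em u li 1≤d W F W⊆F+P w₀ WScr₁≡w₀
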